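{- Let $\Gamma$ be a conservative valued constraint language on a finite domain $D$. The graph $G_\Gamma$ contains the edge $(a_1,b_1)-(a_2,b_2)$ if and only if the binary relation $\{(a_1,b_2),(b_1,a_2)\}$ belongs to $\mathcal{C}(\Gamma)$. The edge is soft if and only if at least one of the binary relations $\{(a_1,a_2),(a_1,b_2),(b_1,a_2)\}$, $\{(b_1,b_2),(a_1,b_2),(b_1,a_2)\}$ belongs to $\mathcal{C}(\Gamma)$.
   Context: A weighted relation of arity $r$ on $D$ is a map $D^r\to\mathbb{Q}\cup\{\infty\}$; a relation has values in $\{0,\infty\}$ and is identified with the set of tuples mapped to $0$. $\mathrm{Feas}(\gamma)=\{\mathbf{x}:\gamma(\mathbf{x})<\infty\}$, $\mathrm{Opt}(\gamma)$ is the relation of tuples in $\mathrm{Feas}(\gamma)$ of minimum value. $\Gamma$ is conservative if it contains all unary weighted relations $D\to\{0,1\}$. $\mathcal{C}(\Gamma)$ is the smallest set of weighted relations on $D$ containing $\Gamma$, all unary weighted relations on $D$ and the binary equality relation on $D$, and closed under: $\mathrm{Feas}$ and $\mathrm{Opt}$; adding a unary weighted relation $\mu$ at a coordinate $i$ ($\gamma'(\mathbf{x})=\gamma(\mathbf{x})+\mu(x_i)$); minimisation at a coordinate $i$ ($\gamma'(x_1,..,x_{i-1},x_{i+1},..,x_r)=\min_{x_i\in D}\gamma(\mathbf{x})$); and join of binary $\gamma_1,\gamma_2$: $\gamma(x,y)=\min_{z\in D}(\gamma_1(u_1,v_1)+\gamma_2(u_2,v_2))$ with $\{u_1,v_1\}=\{x,z\}$,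 $\{u_2,v_2\}=\{y,z\}$ (either order). $G_\Gamma$ is the undirected graph (self-loops allowed) with vertices all pairs $(a,b)\in D^2$ with $a\ne b$, having an edge $(a_1,b_1)-(a_2,b_2)$ iff there is a binary $\gamma\in\mathcal{C}(\Gamma)$ with $(a_1,b_2),(b_1,a_2)\in\mathrm{Feas}(\gamma)$ and $\gamma(a_1,b_2)+\gamma(b_1,a_2)<\gamma(a_1,a_2)+\gamma(b_1,b_2)$. The edge is soft if some such $\gamma$ additionally has at least one of $(a_1,a_2),(b_1,b_2)$ in $\mathrm{Feas}(\gamma)$, and hard otherwise. -}

module Defs where

open import Data.Nat using (ℕ; zero; suc)
open import Data.Fin using (Fin; zero; suc; _≟_)
open import Data.Bool using (Bool; true; false; if_then_else_; _∧_; _∨_)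
open import Data.Rational using (ℚ; _+_; _⊓_; _≤ᵇ_; _<_; 0ℚ; 1ℚ)
open import Data.Vec.Functional using (Vector; insertAt) renaming (_∷_ to _∷ᵥ_; [] to []ᵥ)
open import Data.List using (List; _∷_; [])
open import Data.Bool.ListAction using (any)
open import Data.Product using (_×_; _,_; ∃; ∃-syntax)
open import Data.Sum using (_⊎_)
open import Data.Unit using (⊤)
open import Data.Empty using (⊥)
open import Relation.Nullary using (¬_)
open import Relation.Nullary.Decidable using (⌊_⌋)
open import Relation.Binary.PropositionalEquality using (_≡_)

data ℚ∞ : Set where
  fin : ℚ → ℚ∞
  ∞   : ℚ∞

infixl 6 _+∞_
_+∞_ : ℚ∞ → ℚ∞ → ℚ∞
fin p +∞ fin q = fin (p + q)
_     +∞ _     = ∞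

_⊓∞_ : ℚ∞ → ℚ∞ → ℚ∞
fin p ⊓∞ fin q = fin (p ⊓ q)
fin p ⊓∞ ∞     = fin p
∞     ⊓∞ y     = y

infix 4 _<∞_
_<∞_ : ℚ∞ → ℚ∞ → Set
fin p <∞ fin q = p < q
fin p <∞ ∞     = ⊤
∞     <∞ _     = ⊥

_≤∞ᵇ_ : ℚ∞ → ℚ∞ → Bool
fin p ≤∞ᵇ fin q = p ≤ᵇ q
fin p ≤∞ᵇ ∞     = true
∞     ≤∞ᵇ fin q = false
∞     ≤∞ᵇ ∞     = true

isFin : ℚ∞ → Bool
isFin (fin _) = true
isFin ∞       = false

Feasible : ℚ∞ → Set
Feasible x = x ≡ ∞ → ⊥

WRel : ℕ → ℕ → Set
WRel n r = Vector (Fin n) r → ℚ∞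

app2 : ∀ {n} → WRel n 2 → Fin n → Fin n → ℚ∞
app2 γ x y = γ (x ∷ᵥ y ∷ᵥ []ᵥ)

minD : ∀ {n} → (Fin n → ℚ∞) → ℚ∞
minD {zero}  f = ∞
minD {suc n} f = f zero ⊓∞ minD {n} (λ i → f (suc i))

minAll : ∀ {n r} → WRel n r → ℚ∞
minAll {n} {zero}  γ = γ []ᵥ
minAll {n} {suc r} γ = minD (λ a → minAll {n} {r} (λ xs → γ (a ∷ᵥ xs)))

zeroOrInf : Bool → ℚ∞
zeroOrInf true  = fin 0ℚ
zeroOrInf false = ∞

Feas : ∀ {n r} → WRel n r → WRel n r
Feas γ x = zeroOrInf (isFin (γ x))

Opt : ∀ {n r} → WRel n r → WRel n r
Opt γ x = zeroOrInf (isFin (γ x) ∧ (γ x ≤∞ᵇ minAll γ))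

EqRel : ∀ {n} → WRel n 2
EqRel {n} xs = zeroOrInf ⌊ xs zero ≟ xs (suc zero) ⌋

orient : ∀ {n} → Bool → WRel n 2 → Fin n → Fin n → ℚ∞
orient true  γ x z = app2 γ x z
orient false γ x z = app2 γ z x

join : ∀ {n} → Bool → Bool → WRel n 2 → WRel n 2 → WRel n 2
join o₁ o₂ γ₁ γ₂ xs =
  minD (λ z → orient o₁ γ₁ (xs zero) z +∞ orient o₂ γ₂ (xs (suc zero)) z)

Lang : ℕ → Set₁
Lang n = ∀ {r} → WRel n r → Set

Conservative : ∀ {n} → Lang n → Set
Conservative {n} Γ =
  (μ : WRel n 1) → (∀ x → (μ x ≡ fin 0ℚ) ⊎ (μ x ≡ fin 1ℚ)) → Γ μ

-- The closure 𝒞(Γ).  Weighted relations are functions, so membership is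
-- taken up to pointwise equality (constructor `ext`).
data 𝒞 {n} (Γ : Lang n) : ∀ {r} → WRel n r → Set where
  base   : ∀ {r} {γ : WRel n r} → Γ γ → 𝒞 Γ γ
  unary  : (μ : WRel n 1) → 𝒞 Γ μ
  equal  : 𝒞 Γ EqRel
  feas   : ∀ {r} {γ : WRel n r} → 𝒞 Γ γ → 𝒞 Γ (Feas γ)
  opt    : ∀ {r} {γ : WRel n r} → 𝒞 Γ γ → 𝒞 Γ (Opt γ)
  addU   : ∀ {r} {γ : WRel n r} → 𝒞 Γ γ → (μ : WRel n 1) → (i : Fin r) →
           𝒞 Γ (λ xs → γ xs +∞ μ (xs i ∷ᵥ []ᵥ))
  minim  : ∀ {r} {γ : WRel n (suc r)} → 𝒞 Γ γ → (i : Fin (suc r)) →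
           𝒞 Γ (λ xs → minD (λ a → γ (insertAt xs i a)))
  joinC  : ∀ {γ₁ γ₂ : WRel n 2} → 𝒞 Γ γ₁ → 𝒞 Γ γ₂ → (o₁ o₂ : Bool) →
           𝒞 Γ (join o₁ o₂ γ₁ γ₂)
  ext    : ∀ {r} {γ γ' : WRel n r} → 𝒞 Γ γ → (∀ xs → γ xs ≡ γ' xs) → 𝒞 Γ γ'

pairEq : ∀ {n} → Fin n × Fin n → Fin n → Fin n → Bool
pairEq (a , b) x y = ⌊ a ≟ x ⌋ ∧ ⌊ b ≟ y ⌋

listRel : ∀ {n} → List (Fin n × Fin n) → WRel n 2
listRel ps xs = zeroOrInf (any (λ p → pairEq p (xs zero) (xs (suc zero))) ps)

EdgeWitness : ∀ {n} → WRel n 2 → (a₁ b₁ a₂ b₂ : Fin n) → Set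
EdgeWitness γ a₁ b₁ a₂ b₂ =
  Feasible (app2 γ a₁ b₂) × Feasible (app2 γ b₁ a₂) ×
  (app2 γ a₁ b₂ +∞ app2 γ b₁ a₂ <∞ app2 γ a₁ a₂ +∞ app2 γ b₁ b₂)

-- Vertices of G_Γ are pairs (a,b) with a ≠ b.
Edge : ∀ {n} → Lang n → (a₁ b₁ a₂ b₂ : Fin n) → Set
Edge Γ a₁ b₁ a₂ b₂ =
  ∃[ γ ] (𝒞 Γ {2} γ × EdgeWitness γ a₁ b₁ a₂ b₂)

SoftEdge : ∀ {n} → Lang n → (a₁ b₁ a₂ b₂ : Fin n) → Set
SoftEdge Γ a₁ b₁ a₂ b₂ =
  ∃[ γ ] (𝒞 Γ {2} γ × EdgeWitness γ a₁ b₁ a₂ b₂ ×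
          (Feasible (app2 γ a₁ a₂) ⊎ Feasible (app2 γ b₁ b₂)))

-- Let γ ∈ 𝒞(Γ) witness the edge, with A = γ(a₁,b₂) and B = γ(b₁,a₂) finite.
-- Adding unary weights m(x) + k(y) keeps γ in 𝒞(Γ); with m = ∞ off {a₁,b₁},
-- k = ∞ off {a₂,b₂} and one free parameter s, they can be chosen so that the
-- anti-diagonal (a₁,b₂), (b₁,a₂) costs 0 while the diagonal corners cost
-- γ(a₁,a₂) − A + s and γ(b₁,b₂) − B − s.  The edge inequality says these two
-- costs have positive sum, so s can make both positive, or, when one is finite
-- (a soft edge), make that one 0 and the other positive.  Opt of the
-- reweighted relation is then the required crisp relation.  Conversely, such a
-- crisp relation witnesses the edge itself.
module Submission where

open import Defs
open import Data.Nat using (zero; suc)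
open import Data.Fin using (Fin; zero; suc; _≟_)
open import Data.Fin.Properties using (suc-injective)
open import Data.Bool using (Bool; true; false; T; _∧_; _∨_; if_then_else_)
import Data.Bool.Properties as Bool
open import Data.Bool.ListAction using (any)
open import Data.List using (List; _∷_; []; map)
open import Data.Product using (_×_; _,_; ∃)
open import Data.Sum using (_⊎_; inj₁; inj₂)
open import Data.Unit using (⊤; tt)
open import Data.Empty using (⊥-elim)
open import Data.Rational using (ℚ; _+_; _-_; -_; _*_; _<_; _≤_; _≤ᵇ_; 0ℚ; 1ℚ; ½)
import Data.Rational.Properties as ℚ
open import Data.Rational.Solver using (module +-*-Solver)
open import Function using (_∘_)
open import Function.Bundles using (_⇔_; mk⇔)
open import Relation.Nullary using (yes; no)
open import Relation.Nullary.Decidable using (⌊_⌋)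
open import Relation.Binary.PropositionalEquality

open +-*-Solver

⌊≟⌋-refl : ∀ {n} (a : Fin n) → ⌊ a ≟ a ⌋ ≡ true
⌊≟⌋-refl a with a ≟ a
... | yes _ = refl
... | no a≢a = ⊥-elim (a≢a refl)

⌊≟⌋-≢ : ∀ {n} {a b : Fin n} → a ≢ b → ⌊ a ≟ b ⌋ ≡ false
⌊≟⌋-≢ {a = a} {b} a≢b with a ≟ b
... | yes a≡b = ⊥-elim (a≢b a≡b)
... | no _ = refl

fin-of : ∀ v → Feasible v → ∃ λ q → v ≡ fin q
fin-of (fin q) _ = q , refl
fin-of ∞ infeasible = ⊥-elim (infeasible refl)

Pos∞ : ℚ∞ → Set
Pos∞ v = fin 0ℚ <∞ v

NonNeg∞ : ℚ∞ → Set
NonNeg∞ (fin q) = 0ℚ ≤ q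
NonNeg∞ ∞       = ⊤

ZeroIff : Bool → ℚ∞ → Set
ZeroIff true  v = v ≡ fin 0ℚ
ZeroIff false v = Pos∞ v

zeroIff⇒nonNeg : ∀ b {v} → ZeroIff b v → NonNeg∞ v
zeroIff⇒nonNeg true  refl      = ℚ.≤-refl
zeroIff⇒nonNeg false {fin q} p = ℚ.<⇒≤ p
zeroIff⇒nonNeg false {∞}     _ = tt

+∞-∞ʳ : ∀ u → u +∞ ∞ ≡ ∞
+∞-∞ʳ (fin _) = refl
+∞-∞ʳ ∞       = refl

+∞-identityʳ : ∀ u → u +∞ fin 0ℚ ≡ u
+∞-identityʳ (fin p) = cong fin (ℚ.+-identityʳ p)
+∞-identityʳ ∞       = refl

+∞-regroup : ∀ u {p q p′ q′} → p + q ≡ p′ + q′ →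
             (u +∞ fin p) +∞ fin q ≡ (u +∞ fin p′) +∞ fin q′
+∞-regroup (fin r) {p} {q} {p′} {q′} eq = cong fin (begin
  (r + p) + q    ≡⟨ ℚ.+-assoc r p q ⟩
  r + (p + q)    ≡⟨ cong (r +_) eq ⟩
  r + (p′ + q′)  ≡⟨ ℚ.+-assoc r p′ q′ ⟨
  (r + p′) + q′  ∎)
  where open ≡-Reasoning
+∞-regroup ∞ _ = refl

+∞-feasible : ∀ v {p} → Feasible v → Feasible (v +∞ fin p)
+∞-feasible (fin _) _ ()
+∞-feasible ∞ infeasible _ = infeasible refl

zeroOrInf-+∞ : ∀ u v → u ∧ v ≡ false → zeroOrInf u +∞ zeroOrInf v ≡ ∞
zeroOrInf-+∞ true  true  ()
zeroOrInf-+∞ true  false _ = refl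
zeroOrInf-+∞ false v     _ = refl

⊓∞-identityʳ : ∀ u → u ⊓∞ ∞ ≡ u
⊓∞-identityʳ (fin _) = refl
⊓∞-identityʳ ∞       = refl

⊓∞-nonNeg : ∀ {u v} → NonNeg∞ u → NonNeg∞ v → NonNeg∞ (u ⊓∞ v)
⊓∞-nonNeg {fin p} {fin q} 0≤p 0≤q = ℚ.⊓-glb 0≤p 0≤q
⊓∞-nonNeg {fin p} {∞}     0≤p _   = 0≤p
⊓∞-nonNeg {∞}             _   0≤v = 0≤v

0⊓∞nonNeg : ∀ {v} → NonNeg∞ v → fin 0ℚ ⊓∞ v ≡ fin 0ℚ
0⊓∞nonNeg {fin q} 0≤q = cong fin (ℚ.p≤q⇒p⊓q≡p 0≤q)
0⊓∞nonNeg {∞}     _   = refl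

nonNeg⊓∞0 : ∀ {u} → NonNeg∞ u → u ⊓∞ fin 0ℚ ≡ fin 0ℚ
nonNeg⊓∞0 {fin p} 0≤p = cong fin (ℚ.p≥q⇒p⊓q≡q 0≤p)
nonNeg⊓∞0 {∞}     _   = refl

minD-∞ : ∀ {n} (f : Fin n → ℚ∞) → (∀ z → f z ≡ ∞) → minD f ≡ ∞
minD-∞ {zero}  f _    = refl
minD-∞ {suc n} f f≡∞ rewrite f≡∞ zero = minD-∞ (f ∘ suc) (f≡∞ ∘ suc)

minD-single : ∀ {n} (f : Fin n → ℚ∞) y → (∀ z → z ≢ y → f z ≡ ∞) → minD f ≡ f y
minD-single {suc n} f zero    off =
  trans (cong (f zero ⊓∞_) (minD-∞ (f ∘ suc) (λ z → off (suc z) λ ())))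
        (⊓∞-identityʳ (f zero))
minD-single {suc n} f (suc y) off rewrite off zero (λ ()) =
  minD-single (f ∘ suc) y (λ z z≢y → off (suc z) (z≢y ∘ suc-injective))

minD-nonNeg : ∀ {n} (f : Fin n → ℚ∞) → (∀ z → NonNeg∞ (f z)) → NonNeg∞ (minD f)
minD-nonNeg {zero}  f _      = tt
minD-nonNeg {suc n} f nonNeg = ⊓∞-nonNeg (nonNeg zero) (minD-nonNeg (f ∘ suc) (nonNeg ∘ suc))

minD-attains-0 : ∀ {n} (f : Fin n → ℚ∞) → (∀ z → NonNeg∞ (f z)) →
                 ∀ z₀ → f z₀ ≡ fin 0ℚ → minD f ≡ fin 0ℚ
minD-attains-0 {suc n} f nonNeg zero    f₀ rewrite f₀ =
  0⊓∞nonNeg (minD-nonNeg (f ∘ suc) (nonNeg ∘ suc))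
minD-attains-0 {suc n} f nonNeg (suc z) f₀
  rewrite minD-attains-0 (f ∘ suc) (nonNeg ∘ suc) z f₀ = nonNeg⊓∞0 (nonNeg zero)

0<-subst : ∀ {p q} → p ≡ q → 0ℚ < q → Pos∞ (fin p)
0<-subst refl 0<q = 0<q

0<1 : 0ℚ < 1ℚ
0<1 = ℚ.positive⁻¹ 1ℚ

0<-half : ∀ {r} → 0ℚ < r → 0ℚ < r * ½
0<-half {r} 0<r = subst (_< r * ½) (ℚ.*-zeroˡ ½) (ℚ.*-monoˡ-<-pos ½ 0<r)

excess-pos : ∀ {A B} P Q → fin A +∞ fin B <∞ P +∞ Q →
             Pos∞ ((P +∞ fin (- A)) +∞ (Q +∞ fin (- B)))
excess-pos {A} {B} (fin P) (fin Q) A+B<P+Q =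
  subst₂ _<_ (ℚ.+-inverseʳ (A + B))
    (solve 4 (λ P Q A B → (P :+ Q) :- (A :+ B) := (P :- A) :+ (Q :- B)) refl P Q A B)
    (ℚ.+-monoˡ-< (- (A + B)) A+B<P+Q)
excess-pos (fin P) ∞ _ = tt
excess-pos ∞       Q _ = tt

split-pos : ∀ x y → Pos∞ (x +∞ y) →
            ∃ λ s → Pos∞ (x +∞ fin s) × Pos∞ (y +∞ fin (- s))
split-pos (fin p) (fin q) 0<p+q =
    (p + q) * ½ - p
  , 0<-subst (solve 2 (λ p q → p :+ ((p :+ q) :* con ½ :- p) := (p :+ q) :* con ½) refl p q) half
  , 0<-subst (solve 2 (λ p q → q :+ (:- ((p :+ q) :* con ½ :- p)) := (p :+ q) :* con ½) refl p q) half
  where half = 0<-half 0<p+q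
split-pos (fin p) ∞ _ =
  1ℚ - p , 0<-subst (solve 1 (λ p → p :+ (con 1ℚ :- p) := con 1ℚ) refl p) 0<1 , tt
split-pos ∞ (fin q) _ =
  q - 1ℚ , tt , 0<-subst (solve 1 (λ q → q :+ (:- (q :- con 1ℚ)) := con 1ℚ) refl q) 0<1
split-pos ∞ ∞ _ = 0ℚ , tt , tt

balance-left : ∀ x y → Feasible x → Pos∞ (x +∞ y) →
               ∃ λ s → x +∞ fin s ≡ fin 0ℚ × Pos∞ (y +∞ fin (- s))
balance-left (fin p) y _ 0<p+y = - p , cong fin (ℚ.+-inverseʳ p) , pos y 0<p+y
  where
  pos : ∀ y → Pos∞ (fin p +∞ y) → Pos∞ (y +∞ fin (- - p))
  pos (fin q) 0<p+q = 0<-subst (solve 2 (λ p q → q :+ (:- (:- p)) := p :+ q) refl p q) 0<p+q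
  pos ∞       _     = tt
balance-left ∞ y infeasible _ = ⊥-elim (infeasible refl)

balance-right : ∀ x y → Feasible y → Pos∞ (x +∞ y) →
                ∃ λ s → Pos∞ (x +∞ fin s) × y +∞ fin (- s) ≡ fin 0ℚ
balance-right x (fin q) _ 0<x+q = q , 0<x+q , cong fin (ℚ.+-inverseʳ q)
balance-right x ∞ infeasible _ = ⊥-elim (infeasible refl)

binary : ∀ {n} → (Fin n → Fin n → ℚ∞) → WRel n 2
binary f xs = f (xs zero) (xs (suc zero))

zeroIff-opt : ∀ b {v} → ZeroIff b v → zeroOrInf (isFin v ∧ (v ≤∞ᵇ fin 0ℚ)) ≡ zeroOrInf b
zeroIff-opt true  refl = refl
zeroIff-opt false {∞} _ = refl
zeroIff-opt false {fin r} 0<r with r ≤ᵇ 0ℚ in r≤0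
... | false = refl
... | true  = ⊥-elim (ℚ.<-irrefl refl (ℚ.<-≤-trans 0<r (ℚ.≤ᵇ⇒≤ (subst T (sym r≤0) tt))))

module _ {n} {Γ : Lang n} where

  -- A functional vector xs is not definitionally xs 0 ∷ xs 1 ∷ [];
  -- joining with the equality relation performs this η-expansion inside 𝒞(Γ).
  𝒞-η : ∀ {γ} → 𝒞 Γ γ → 𝒞 Γ (binary (app2 γ))
  𝒞-η {γ} 𝒞γ = ext (joinC 𝒞γ equal true true) λ xs → join-equality (xs zero) (xs (suc zero))
    where
    join-equality : ∀ x y → minD (λ z → app2 γ x z +∞ zeroOrInf ⌊ y ≟ z ⌋) ≡ app2 γ x y
    join-equality x y = begin
      minD (λ z → app2 γ x z +∞ zeroOrInf ⌊ y ≟ z ⌋)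
        ≡⟨ minD-single _ y (λ z z≢y → trans (cong (λ b → app2 γ x z +∞ zeroOrInf b) (⌊≟⌋-≢ (z≢y ∘ sym)))
                                             (+∞-∞ʳ _)) ⟩
      app2 γ x y +∞ zeroOrInf ⌊ y ≟ y ⌋
        ≡⟨ cong (λ b → app2 γ x y +∞ zeroOrInf b) (⌊≟⌋-refl y) ⟩
      app2 γ x y +∞ fin 0ℚ
        ≡⟨ +∞-identityʳ _ ⟩
      app2 γ x y ∎
      where open ≡-Reasoning

  𝒞-reweight : ∀ {f} → 𝒞 Γ (binary f) → (m k : Fin n → ℚ∞) →
               𝒞 Γ (binary (λ x y → (f x y +∞ m x) +∞ k y))
  𝒞-reweight 𝒞f m k = addU (addU 𝒞f (λ v → m (v zero)) zero) (λ v → k (v zero)) (suc zero)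

  𝒞-zeros : ∀ {f} → 𝒞 Γ (binary f) → (R : Fin n → Fin n → Bool) →
            (∀ x y → ZeroIff (R x y) (f x y)) → ∀ x₀ y₀ → R x₀ y₀ ≡ true →
            𝒞 Γ (binary (λ x y → zeroOrInf (R x y)))
  𝒞-zeros {f} 𝒞f R zeros x₀ y₀ R₀ =
    ext (opt 𝒞f) λ xs → trans (cong (λ μ → zeroOrInf (isFin (binary f xs) ∧ (binary f xs ≤∞ᵇ μ))) min≡0)
                              (zeroIff-opt (R (xs zero) (xs (suc zero))) (zeros (xs zero) (xs (suc zero))))
    where
    nonNeg : ∀ x y → NonNeg∞ (f x y)
    nonNeg x y = zeroIff⇒nonNeg (R x y) (zeros x y)

    f₀≡0 : f x₀ y₀ ≡ fin 0ℚ
    f₀≡0 = subst (λ b → ZeroIff b (f x₀ y₀)) R₀ (zeros x₀ y₀)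

    min≡0 : minAll (binary f) ≡ fin 0ℚ
    min≡0 = minD-attains-0 _ (λ x → minD-nonNeg _ (nonNeg x)) x₀
              (minD-attains-0 _ (nonNeg x₀) y₀ f₀≡0)

pick : ∀ {n} → Fin n → Fin n → Bool → Fin n
pick a b true  = a
pick a b false = b

pinned : ∀ {n} → Fin n → Fin n → (Bool → ℚ) → Fin n → ℚ∞
pinned a b w x = if ⌊ a ≟ x ⌋ then fin (w true) else if ⌊ b ≟ x ⌋ then fin (w false) else ∞

module _ {n} {a b : Fin n} (a≢b : a ≢ b) where

  pick-≟ : ∀ i j → ⌊ pick a b i ≟ pick a b j ⌋ ≡ ⌊ i Bool.≟ j ⌋
  pick-≟ true  true  = ⌊≟⌋-refl a
  pick-≟ true  false = ⌊≟⌋-≢ a≢b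
  pick-≟ false true  = ⌊≟⌋-≢ (a≢b ∘ sym)
  pick-≟ false false = ⌊≟⌋-refl b

  pinned-pick : ∀ w i → pinned a b w (pick a b i) ≡ fin (w i)
  pinned-pick w true  rewrite ⌊≟⌋-refl a = refl
  pinned-pick w false rewrite ⌊≟⌋-≢ a≢b | ⌊≟⌋-refl b = refl

pick? : ∀ {n} (a b x : Fin n) → (∃ λ i → pick a b i ≡ x) ⊎ (∀ i → pick a b i ≢ x)
pick? a b x with a ≟ x | b ≟ x
... | yes a≡x | _       = inj₁ (true , a≡x)
... | no _    | yes b≡x = inj₁ (false , b≡x)
... | no a≢x  | no b≢x  = inj₂ λ { true → a≢x ; false → b≢x }

pinned-off : ∀ {n} {a b x : Fin n} w → (∀ i → pick a b i ≢ x) → pinned a b w x ≡ ∞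
pinned-off w off rewrite ⌊≟⌋-≢ (off true) | ⌊≟⌋-≢ (off false) = refl

hasPair : ∀ {n} → List (Fin n × Fin n) → Fin n → Fin n → Bool
hasPair ps x y = any (λ p → pairEq p x y) ps

_∈ᵇ_ : Bool × Bool → List (Bool × Bool) → Bool
(i , j) ∈ᵇ S = any (λ (i′ , j′) → ⌊ i′ Bool.≟ i ⌋ ∧ ⌊ j′ Bool.≟ j ⌋) S

module Grid {n} (Γ : Lang n) {a₁ b₁ a₂ b₂ : Fin n} (a₁≢b₁ : a₁ ≢ b₁) (a₂≢b₂ : a₂ ≢ b₂) where

  row col : Bool → Fin n
  row = pick a₁ b₁
  col = pick a₂ b₂

  corner : Bool × Bool → Fin n × Fin n
  corner (i , j) = row i , col j

  hasPair-corner : ∀ S i j → hasPair (map corner S) (row i) (col j) ≡ (i , j) ∈ᵇ S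
  hasPair-corner []              i j = refl
  hasPair-corner ((i′ , j′) ∷ S) i j =
    cong₂ _∨_ (cong₂ _∧_ (pick-≟ a₁≢b₁ i′ i) (pick-≟ a₂≢b₂ j′ j)) (hasPair-corner S i j)

  hasPair-offRow : ∀ S {x} y → (∀ i → row i ≢ x) → hasPair (map corner S) x y ≡ false
  hasPair-offRow []              y off = refl
  hasPair-offRow ((i′ , j′) ∷ S) y off =
    cong₂ _∨_ (cong (_∧ _) (⌊≟⌋-≢ (off i′))) (hasPair-offRow S y off)

  hasPair-offCol : ∀ S x {y} → (∀ j → col j ≢ y) → hasPair (map corner S) x y ≡ false
  hasPair-offCol []              x off = refl
  hasPair-offCol ((i′ , j′) ∷ S) x off =
    cong₂ _∨_ (trans (cong (_ ∧_) (⌊≟⌋-≢ (off j′))) (Bool.∧-zeroʳ _)) (hasPair-offCol S x off)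

  𝒞-corners : ∀ {γ} → 𝒞 Γ γ → (α κ : Bool → ℚ) (S : List (Bool × Bool)) →
    (∀ i j → ZeroIff ((i , j) ∈ᵇ S) ((app2 γ (row i) (col j) +∞ fin (α i)) +∞ fin (κ j))) →
    ∀ i₀ j₀ → (i₀ , j₀) ∈ᵇ S ≡ true → 𝒞 Γ (listRel (map corner S))
  𝒞-corners {γ} 𝒞γ α κ S corners i₀ j₀ c₀∈S =
    𝒞-zeros {f = F} (𝒞-reweight {f = app2 γ} (𝒞-η 𝒞γ) (pinned a₁ b₁ α) (pinned a₂ b₂ κ))
            (hasPair (map corner S)) zeros (row i₀) (col j₀) (trans (hasPair-corner S i₀ j₀) c₀∈S)
    where
    F : Fin n → Fin n → ℚ∞
    F x y = (app2 γ x y +∞ pinned a₁ b₁ α x) +∞ pinned a₂ b₂ κ y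

    F-corner : ∀ i j → F (row i) (col j) ≡ (app2 γ (row i) (col j) +∞ fin (α i)) +∞ fin (κ j)
    F-corner i j = cong₂ (λ u v → (app2 γ (row i) (col j) +∞ u) +∞ v)
                         (pinned-pick a₁≢b₁ α i) (pinned-pick a₂≢b₂ κ j)

    zeros : ∀ x y → ZeroIff (hasPair (map corner S) x y) (F x y)
    zeros x y with pick? a₁ b₁ x | pick? a₂ b₂ y
    ... | inj₁ (i , refl) | inj₁ (j , refl) =
      subst₂ ZeroIff (sym (hasPair-corner S i j)) (sym (F-corner i j)) (corners i j)
    ... | inj₂ offRow | _ =
      subst₂ ZeroIff (sym (hasPair-offRow S y offRow))
        (sym (cong (_+∞ pinned a₂ b₂ κ y) (trans (cong (app2 γ x y +∞_) (pinned-off α offRow)) (+∞-∞ʳ _))))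
        tt
    ... | inj₁ _ | inj₂ offCol =
      subst₂ ZeroIff (sym (hasPair-offCol S x offCol))
        (sym (trans (cong (_ +∞_) (pinned-off κ offCol)) (+∞-∞ʳ _)))
        tt

  -- With weights α = (−A, −(B + s)) on the rows and κ = (s, 0) on the columns
  -- the anti-diagonal costs vanish and the diagonal costs are shifted by ±s.
  𝒞-crispGrid : ∀ {γ A B} → 𝒞 Γ γ → app2 γ a₁ b₂ ≡ fin A → app2 γ b₁ a₂ ≡ fin B →
    (s : ℚ) (S : List (Bool × Bool)) → (true , false) ∈ᵇ S ≡ true → (false , true) ∈ᵇ S ≡ true →
    ZeroIff ((true , true) ∈ᵇ S) ((app2 γ a₁ a₂ +∞ fin (- A)) +∞ fin s) →
    ZeroIff ((false , false) ∈ᵇ S) ((app2 γ b₁ b₂ +∞ fin (- B)) +∞ fin (- s)) →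
    𝒞 Γ (listRel (map corner S))
  𝒞-crispGrid {γ} {A} {B} 𝒞γ γa₁b₂ γb₁a₂ s S a₁b₂∈S b₁a₂∈S a₁a₂ b₁b₂ =
    𝒞-corners 𝒞γ α κ S corners true false a₁b₂∈S
    where
    α κ : Bool → ℚ
    α true  = - A
    α false = - (B + s)
    κ true  = s
    κ false = 0ℚ

    corners : ∀ i j → ZeroIff ((i , j) ∈ᵇ S) ((app2 γ (row i) (col j) +∞ fin (α i)) +∞ fin (κ j))
    corners true  true  = a₁a₂
    corners true  false rewrite γa₁b₂ | a₁b₂∈S =
      cong fin (solve 1 (λ A → (A :- A) :+ con 0ℚ := con 0ℚ) refl A)
    corners false true  rewrite γb₁a₂ | b₁a₂∈S =
      cong fin (solve 2 (λ B s → (B :- (B :+ s)) :+ s := con 0ℚ) refl B s)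
    corners false false =
      subst (ZeroIff ((false , false) ∈ᵇ S)) (+∞-regroup (app2 γ b₁ b₂) {p = - B} {q = - s} {p′ = - (B + s)} {q′ = 0ℚ} (solve 2 (λ B s → :- B :- s := :- (B :+ s) :+ con 0ℚ) refl B s)) b₁b₂

  antidiagonal : List (Bool × Bool)
  antidiagonal = (true , false) ∷ (false , true) ∷ []

  antidiagonal⁺ : Bool → List (Bool × Bool)
  antidiagonal⁺ i = (i , i) ∷ antidiagonal

  listRel-corner : ∀ S i j → app2 (listRel (map corner S)) (row i) (col j) ≡ zeroOrInf ((i , j) ∈ᵇ S)
  listRel-corner S i j = cong zeroOrInf (hasPair-corner S i j)

  listRel-feasible : ∀ S i j → (i , j) ∈ᵇ S ≡ true → Feasible (app2 (listRel (map corner S)) (row i) (col j))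
  listRel-feasible S i j c∈S c∞ with () ← trans (sym (trans (listRel-corner S i j) (cong zeroOrInf c∈S))) c∞

  listRel-witness : ∀ S → (true , false) ∈ᵇ S ≡ true → (false , true) ∈ᵇ S ≡ true →
    (true , true) ∈ᵇ S ∧ (false , false) ∈ᵇ S ≡ false →
    EdgeWitness (listRel (map corner S)) a₁ b₁ a₂ b₂
  listRel-witness S a₁b₂∈S b₁a₂∈S diagonal∉S =
      listRel-feasible S true false a₁b₂∈S
    , listRel-feasible S false true b₁a₂∈S
    , subst₂ _<∞_ (sym (cong₂ _+∞_ (on true false a₁b₂∈S) (on false true b₁a₂∈S)))
                  (sym (trans (cong₂ _+∞_ (listRel-corner S true true) (listRel-corner S false false))
                              (zeroOrInf-+∞ _ _ diagonal∉S)))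
                  tt
    where
    on : ∀ i j → (i , j) ∈ᵇ S ≡ true → app2 (listRel (map corner S)) (row i) (col j) ≡ fin 0ℚ
    on i j c∈S = trans (listRel-corner S i j) (cong zeroOrInf c∈S)

  diagonal-excess : ∀ {γ A B} → app2 γ a₁ b₂ ≡ fin A → app2 γ b₁ a₂ ≡ fin B →
    app2 γ a₁ b₂ +∞ app2 γ b₁ a₂ <∞ app2 γ a₁ a₂ +∞ app2 γ b₁ b₂ →
    Pos∞ ((app2 γ a₁ a₂ +∞ fin (- A)) +∞ (app2 γ b₁ b₂ +∞ fin (- B)))
  diagonal-excess {γ} γa₁b₂ γb₁a₂ cheaper =
    excess-pos _ _ (subst₂ (λ u v → u +∞ v <∞ app2 γ a₁ a₂ +∞ app2 γ b₁ b₂) γa₁b₂ γb₁a₂ cheaper)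

  edge⇒𝒞 : Edge Γ a₁ b₁ a₂ b₂ → 𝒞 Γ (listRel (map corner antidiagonal))
  edge⇒𝒞 (γ , 𝒞γ , feasible₁ , feasible₂ , cheaper)
    with A , γa₁b₂ ← fin-of _ feasible₁ | B , γb₁a₂ ← fin-of _ feasible₂
    with s , pos₁ , pos₂ ← split-pos _ _ (diagonal-excess {γ} γa₁b₂ γb₁a₂ cheaper)
    = 𝒞-crispGrid 𝒞γ γa₁b₂ γb₁a₂ s antidiagonal refl refl pos₁ pos₂

  𝒞⇒edge : 𝒞 Γ (listRel (map corner antidiagonal)) → Edge Γ a₁ b₁ a₂ b₂
  𝒞⇒edge 𝒞ρ = _ , 𝒞ρ , listRel-witness antidiagonal refl refl refl

  soft⇒𝒞 : SoftEdge Γ a₁ b₁ a₂ b₂ →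
    𝒞 Γ (listRel (map corner (antidiagonal⁺ true))) ⊎ 𝒞 Γ (listRel (map corner (antidiagonal⁺ false)))
  soft⇒𝒞 (γ , 𝒞γ , (feasible₁ , feasible₂ , cheaper) , diagonal)
    with A , γa₁b₂ ← fin-of _ feasible₁ | B , γb₁a₂ ← fin-of _ feasible₂ | diagonal
  ... | inj₁ feasible-a₁a₂
    with s , zero₁ , pos₂ ← balance-left _ _ (+∞-feasible _ feasible-a₁a₂) (diagonal-excess {γ} γa₁b₂ γb₁a₂ cheaper)
    = inj₁ (𝒞-crispGrid 𝒞γ γa₁b₂ γb₁a₂ s (antidiagonal⁺ true) refl refl zero₁ pos₂)
  ... | inj₂ feasible-b₁b₂
    with s , pos₁ , zero₂ ← balance-right _ _ (+∞-feasible _ feasible-b₁b₂) (diagonal-excess {γ} γa₁b₂ γb₁a₂ cheaper)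
    = inj₂ (𝒞-crispGrid 𝒞γ γa₁b₂ γb₁a₂ s (antidiagonal⁺ false) refl refl pos₁ zero₂)

  𝒞⇒soft : 𝒞 Γ (listRel (map corner (antidiagonal⁺ true))) ⊎ 𝒞 Γ (listRel (map corner (antidiagonal⁺ false))) →
    SoftEdge Γ a₁ b₁ a₂ b₂
  𝒞⇒soft (inj₁ 𝒞ρ) = _ , 𝒞ρ , listRel-witness (antidiagonal⁺ true) refl refl refl
                       , inj₁ (listRel-feasible (antidiagonal⁺ true) true true refl)
  𝒞⇒soft (inj₂ 𝒞ρ) = _ , 𝒞ρ , listRel-witness (antidiagonal⁺ false) refl refl refl
                       , inj₂ (listRel-feasible (antidiagonal⁺ false) false false refl)

lemma4p6 : ∀ {n} (Γ : Lang n) → Conservative Γ →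
    (a₁ b₁ a₂ b₂ : Fin n) → a₁ ≢ b₁ → a₂ ≢ b₂ →
    (Edge Γ a₁ b₁ a₂ b₂ ⇔ 𝒞 Γ (listRel ((a₁ , b₂) ∷ (b₁ , a₂) ∷ [])))
    × (SoftEdge Γ a₁ b₁ a₂ b₂ ⇔
        (𝒞 Γ (listRel ((a₁ , a₂) ∷ (a₁ , b₂) ∷ (b₁ , a₂) ∷ []))
         ⊎ 𝒞 Γ (listRel ((b₁ , b₂) ∷ (a₁ , b₂) ∷ (b₁ , a₂) ∷ []))))
lemma4p6 Γ _ a₁ b₁ a₂ b₂ a₁≢b₁ a₂≢b₂ = mk⇔ edge⇒𝒞 𝒞⇒edge , mk⇔ soft⇒𝒞 𝒞⇒soft
  where open Grid Γ a₁≢b₁ a₂≢b₂
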